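{- Let $\mathcal{M}=\{M_1,\dots,M_m\}$ be a primitive set of $n\times n$ binary NZ matrices, and let $\mathrm{Aut}(\mathcal{M})$ and $\mathrm{Aut}(\mathcal{M}^{\top})$ be its associated automata. Then for every integer $k$ with $2\le k\le n$, \[ rt_k(\mathcal{M})=\min\bigl\{rt_k(\mathrm{Aut}(\mathcal{M})),\ rt_k(\mathrm{Aut}(\mathcal{M}^{\top}))\bigr\}. \]
   Context: All matrices are nonnegative; products of binary matrices are Boolean products ($(AB)_{ij}=1$ iff $\sum_s A_{is}B_{sj}>0$). A matrix is NZ if every row and every column has at least one positive entry. A finite set $\mathcal{M}$ of $n\times n$ nonnegative matrices is primitive if some finite product of matrices from $\mathcal{M}$ (repetitions allowed) is entrywise positive. For a set $\mathcal{M}$ of matrices, $rt_k(\mathcal{M})$ is the length of the shortest product of matrices from $\mathcal{M}$ having a column or a row with at least $k$ positive entries. The associated automaton $\mathrm{Aut}(\mathcal{M})$ is the set of all binary row-stochastic $n\times n$ matrices $A$ (exactly one entry equal to $1$ in each row, zeros elsewhere) such that $A\le M$ entrywise for some $M\in\mathcal{M}$; $\mathrm{Aut}(\mathcal{M}^{\top})$ is defined in the same way from $\mathcal{M}^{\top}=\{M_1^{\top},\dots,M_m^{\top}\}$. Such an automaton (a set of binary row-stochastic matrices, the letters; a word is a product of letters) has $rt_k$ equal to the length of the shortest word whose matrix has a column with at least $k$ entries equal to $1$, i.e. the shortest word mapping some set of $k$ states to a single state. -}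

module Defs where

open import Data.Nat using (ℕ; zero; suc; _≤_; _⊓_)
open import Data.Bool using (Bool; true; false; _∧_; _∨_; if_then_else_)
open import Data.Fin using (Fin; zero; suc; _≟_)
open import Data.List using (List; []; _∷_; length)
open import Data.Maybe using (Maybe; just; nothing)
open import Data.Product using (Σ; ∃; _×_; _,_)
open import Data.Sum using (_⊎_)
open import Relation.Nullary.Decidable using (⌊_⌋)
open import Relation.Binary.PropositionalEquality using (_≡_)

Mat : ℕ → Set
Mat n = Fin n → Fin n → Bool

anyFin : ∀ {n} → (Fin n → Bool) → Bool
anyFin {zero}  f = false
anyFin {suc n} f = f zero ∨ anyFin (λ i → f (suc i))

countTrue : ∀ {n} → (Fin n → Bool) → ℕ
countTrue {zero}  f = 0
countTrue {suc n} f = (if f zero then 1 else 0) + countTrue (λ i → f (suc i))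
  where open Data.Nat using (_+_)

_⊗_ : ∀ {n} → Mat n → Mat n → Mat n
(A ⊗ B) i j = anyFin (λ s → A i s ∧ B s j)

transpose : ∀ {n} → Mat n → Mat n
transpose A i j = A j i

_≤ᴹ_ : ∀ {n} → Mat n → Mat n → Set
A ≤ᴹ B = ∀ i j → A i j ≡ true → B i j ≡ true

NZ : ∀ {n} → Mat n → Set
NZ {n} A = (∀ i → ∃ λ j → A i j ≡ true) × (∀ j → ∃ λ i → A i j ≡ true)

-- A set of matrices, presented as an indexed family I → Mat n.
-- A word is a nonempty list of letters (i , w), representing the
-- product  M i ⊗ M w₁ ⊗ ... ⊗ M wₗ,  of length 1 + length w.
Word : Set → Set
Word I = I × List I

wordLength : ∀ {I} → Word I → ℕ
wordLength (i , w) = suc (length w)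

prodList : ∀ {n} {I : Set} → (I → Mat n) → I → List I → Mat n
prodList M i []       = M i
prodList M i (j ∷ w)  = M i ⊗ prodList M j w

prodWord : ∀ {n} {I : Set} → (I → Mat n) → Word I → Mat n
prodWord M (i , w) = prodList M i w

Primitive : ∀ {n} {I : Set} → (I → Mat n) → Set
Primitive {n} {I} M = Σ (Word I) λ w → ∀ i j → prodWord M w i j ≡ true

HasRowOrCol : ∀ {n} → ℕ → Mat n → Set
HasRowOrCol k A = (∃ λ i → k ≤ countTrue (λ j → A i j))
                ⊎ (∃ λ j → k ≤ countTrue (λ i → A i j))

HasCol : ∀ {n} → ℕ → Mat n → Set
HasCol k A = ∃ λ j → k ≤ countTrue (λ i → A i j)

-- "ShortestIs P M r": r (in ℕ ∪ {∞}, with nothing = ∞) is the length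
-- of the shortest word over M whose product satisfies P
ShortestIs : ∀ {n} {I : Set} → (Mat n → Set) → (I → Mat n) → Maybe ℕ → Set
ShortestIs {n} {I} P M (just r) =
  (Σ (Word I) λ w → wordLength w ≡ r × P (prodWord M w))
  × (∀ (w : Word I) → P (prodWord M w) → r ≤ wordLength w)
ShortestIs {n} {I} P M nothing =
  ∀ (w : Word I) → P (prodWord M w) → Data.Empty.⊥
  where import Data.Empty

rtMatIs : ∀ {n} {I : Set} → ℕ → (I → Mat n) → Maybe ℕ → Set
rtMatIs k M r = ShortestIs (HasRowOrCol k) M r

rtAutIs : ∀ {n} {I : Set} → ℕ → (I → Mat n) → Maybe ℕ → Set
rtAutIs k M r = ShortestIs (HasCol k) M r

funMat : ∀ {n} → (Fin n → Fin n) → Mat n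
funMat f i j = ⌊ f i ≟ j ⌋

-- Aut(M): all binary row-stochastic A with A ≤ M_i for some i.
-- Letters: pairs (i , f) with funMat f ≤ M i (every binary row-stochastic
-- matrix is funMat f for a unique f).
AutLetter : ∀ {n} {m : ℕ} → (Fin m → Mat n) → Set
AutLetter {n} {m} M = Σ (Fin m) λ i → Σ (Fin n → Fin n) λ f → funMat f ≤ᴹ M i

Aut : ∀ {n} {m : ℕ} → (M : Fin m → Mat n) → AutLetter M → Mat n
Aut M (i , f , _) = funMat f

transposeSet : ∀ {n} {m : ℕ} → (Fin m → Mat n) → (Fin m → Mat n)
transposeSet M i = transpose (M i)

min∞ : Maybe ℕ → Maybe ℕ → Maybe ℕ
min∞ (just a) (just b) = just (a ⊓ b)
min∞ (just a) nothing  = just a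
min∞ nothing  b        = b

-- A word over Aut(M) is dominated entrywise by the product of the underlying word over M,
-- and a word over Aut(Mᵀ), read backwards, by the transpose of a product over M; so
-- automaton words never beat matrix words of the same length. Conversely, given a column j
-- of a product M_{i₁} ⋯ M_{iₗ}, send each state y to a successor x under M_{i₁} from which
-- the rest of the word still reaches j, if there is one, and to any successor otherwise
-- (rows are nonzero); repeating this along the word gives an automaton word of the same
-- length whose product keeps every 1 of column j. Rows are handled by transposing.
module Submission where

open import Defs
open import Data.Bool using (Bool; true; false; _∧_; _∨_)
open import Data.Bool.Properties using (∧-conicalˡ; ∧-conicalʳ; ∨-zeroʳ) renaming (_≟_ to _≟ᵇ_)
open import Data.Empty using (⊥-elim)
open import Data.Fin using (Fin; zero; suc; _≟_)
open import Data.Fin.Properties using (any?)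
open import Data.List using (List; []; _∷_; length; map)
open import Data.List.Properties using (length-map)
open import Data.Maybe using (Maybe; just; nothing)
open import Data.Nat using (ℕ; zero; suc; _≤_; _+_; _⊓_; s≤s; z≤n)
open import Data.Nat.Properties
  using (≤-trans; ≤-antisym; ≤-total; m≤n⇒m≤1+n; +-suc; +-identityʳ;
         m⊓n≤m; m⊓n≤n; m≤n⇒m⊓n≡m; m≥n⇒m⊓n≡n)
open import Data.Product using (Σ; ∃; _×_; _,_; proj₁; proj₂)
import Data.Product as Product
open import Data.Sum using (inj₁; inj₂)
open import Function using (_∘_; id)
open import Level using (0ℓ)
open import Relation.Nullary using (yes; no; contradiction)
open import Relation.Nullary.Decidable using (⌊_⌋; isYes≗does; dec-true)
open import Relation.Unary using (Pred; Empty; _⊆_; _∪_; _≐_)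
open import Relation.Binary.PropositionalEquality using (_≡_; refl; sym; trans; cong; subst)

private
  variable
    n m k : ℕ
    I : Set

MinimumIs : Pred ℕ 0ℓ → Maybe ℕ → Set
MinimumIs L (just r) = L r × L ⊆ (r ≤_)
MinimumIs L nothing  = Empty L

minimumIs-unique : {L L′ : Pred ℕ 0ℓ} {a a′ : Maybe ℕ}
  → L ≐ L′ → MinimumIs L a → MinimumIs L′ a′ → a ≡ a′
minimumIs-unique {a = just r} {just r′} (L⊆L′ , L′⊆L) (Lr , r≤) (L′r′ , r′≤) =
  cong just (≤-antisym (r≤ (L′⊆L L′r′)) (r′≤ (L⊆L′ Lr)))
minimumIs-unique {a = just r} {nothing} (L⊆L′ , _) (Lr , _) empty = ⊥-elim (empty r (L⊆L′ Lr))
minimumIs-unique {a = nothing} {just r′} (_ , L′⊆L) empty (L′r′ , _) = ⊥-elim (empty r′ (L′⊆L L′r′))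
minimumIs-unique {a = nothing} {nothing} _ _ _ = refl

minimumIs-∪ : {L₁ L₂ : Pred ℕ 0ℓ} {b c : Maybe ℕ}
  → MinimumIs L₁ b → MinimumIs L₂ c → MinimumIs (L₁ ∪ L₂) (min∞ b c)
minimumIs-∪ {L₁} {L₂} {just b} {just c} (L₁b , b≤) (L₂c , c≤) = attained , lower
  where
  attained : (L₁ ∪ L₂) (b ⊓ c)
  attained with ≤-total b c
  ... | inj₁ b≤c = subst (L₁ ∪ L₂) (sym (m≤n⇒m⊓n≡m b≤c)) (inj₁ L₁b)
  ... | inj₂ c≤b = subst (L₁ ∪ L₂) (sym (m≥n⇒m⊓n≡n c≤b)) (inj₂ L₂c)
  lower : (L₁ ∪ L₂) ⊆ (b ⊓ c ≤_)
  lower (inj₁ L₁ℓ) = ≤-trans (m⊓n≤m b c) (b≤ L₁ℓ)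
  lower (inj₂ L₂ℓ) = ≤-trans (m⊓n≤n b c) (c≤ L₂ℓ)
minimumIs-∪ {b = just b} {nothing} (L₁b , b≤) empty =
  inj₁ L₁b , λ { (inj₁ L₁ℓ) → b≤ L₁ℓ ; (inj₂ L₂ℓ) → ⊥-elim (empty _ L₂ℓ) }
minimumIs-∪ {b = nothing} {just c} empty (L₂c , c≤) =
  inj₂ L₂c , λ { (inj₁ L₁ℓ) → ⊥-elim (empty _ L₁ℓ) ; (inj₂ L₂ℓ) → c≤ L₂ℓ }
minimumIs-∪ {b = nothing} {nothing} empty₁ empty₂ ℓ (inj₁ L₁ℓ) = empty₁ ℓ L₁ℓ
minimumIs-∪ {b = nothing} {nothing} empty₁ empty₂ ℓ (inj₂ L₂ℓ) = empty₂ ℓ L₂ℓ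

Attains : (Mat n → Set) → (I → Mat n) → Pred ℕ 0ℓ
Attains {I = I} P M ℓ = Σ (Word I) λ w → wordLength w ≡ ℓ × P (prodWord M w)

shortestIs⇒minimumIs : {P : Mat n → Set} {M : I → Mat n} {r : Maybe ℕ}
  → ShortestIs P M r → MinimumIs (Attains P M) r
shortestIs⇒minimumIs {r = just r} (attained , r≤) =
  attained , λ { (w , refl , Pw) → r≤ w Pw }
shortestIs⇒minimumIs {r = nothing} none ℓ (w , _ , Pw) = none w Pw

mapWord : {A B : Set} → (A → B) → Word A → Word B
mapWord f = Product.map f (map f)

wordLength-mapWord : {A B : Set} (f : A → B) (w : Word A) → wordLength (mapWord f w) ≡ wordLength w
wordLength-mapWord f (a , as) = cong suc (length-map f as)

reverseOnto : I → List I → List I → Word I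
reverseOnto i acc []      = i , acc
reverseOnto i acc (j ∷ w) = reverseOnto j (i ∷ acc) w

reverseWord : Word I → Word I
reverseWord (i , w) = reverseOnto i [] w

length-reverseOnto : (i : I) (acc w : List I) → length (proj₂ (reverseOnto i acc w)) ≡ length acc + length w
length-reverseOnto i acc []      = sym (+-identityʳ (length acc))
length-reverseOnto i acc (j ∷ w) = trans (length-reverseOnto j (i ∷ acc) w) (sym (+-suc (length acc) (length w)))

wordLength-reverseWord : (w : Word I) → wordLength (reverseWord w) ≡ wordLength w
wordLength-reverseWord (i , w) = cong suc (length-reverseOnto i [] w)

anyFin-intro : (f : Fin n → Bool) (s : Fin n) → f s ≡ true → anyFin f ≡ true
anyFin-intro f zero    fs = cong (_∨ anyFin (f ∘ suc)) fs
anyFin-intro f (suc s) fs = trans (cong (f zero ∨_) (anyFin-intro (f ∘ suc) s fs)) (∨-zeroʳ (f zero))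

anyFin-elim : (f : Fin n → Bool) → anyFin f ≡ true → ∃ λ s → f s ≡ true
anyFin-elim {suc n} f any with f zero in f0
... | true  = zero , f0
... | false = Product.map suc (λ fs → fs) (anyFin-elim (f ∘ suc) any)

∧-intro : {x y : Bool} → x ≡ true → y ≡ true → x ∧ y ≡ true
∧-intro refl refl = refl

countTrue-mono : (f g : Fin n → Bool) → (∀ i → f i ≡ true → g i ≡ true) → countTrue f ≤ countTrue g
countTrue-mono {zero}  f g f⇒g = z≤n
countTrue-mono {suc n} f g f⇒g with f zero in f0 | g zero in g0
... | true  | true  = s≤s (countTrue-mono (f ∘ suc) (g ∘ suc) (f⇒g ∘ suc))
... | true  | false = contradiction (trans (sym (f⇒g zero f0)) g0) λ ()
... | false | true  = m≤n⇒m≤1+n (countTrue-mono (f ∘ suc) (g ∘ suc) (f⇒g ∘ suc))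
... | false | false = countTrue-mono (f ∘ suc) (g ∘ suc) (f⇒g ∘ suc)

⊗-mono : {A A′ B B′ : Mat n} → A ≤ᴹ A′ → B ≤ᴹ B′ → (A ⊗ B) ≤ᴹ (A′ ⊗ B′)
⊗-mono {A = A} {A′} {B} {B′} A≤A′ B≤B′ i j AB with anyFin-elim (λ s → A i s ∧ B s j) AB
... | s , AsB = anyFin-intro (λ s → A′ i s ∧ B′ s j) s
  (∧-intro (A≤A′ i s (∧-conicalˡ _ _ AsB)) (B≤B′ s j (∧-conicalʳ _ _ AsB)))

funMat-diag : (f : Fin n → Fin n) (y : Fin n) → funMat f y (f y) ≡ true
funMat-diag f y = trans (isYes≗does (f y ≟ f y)) (dec-true (f y ≟ f y) refl)

⌊≟⌋-true⇒≡ : {x y : Fin n} → ⌊ x ≟ y ⌋ ≡ true → x ≡ y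
⌊≟⌋-true⇒≡ {x = x} {y} x≟y with x ≟ y
... | yes x≡y = x≡y
... | no _    = contradiction x≟y λ ()

funMat-≤ᴹ : (f : Fin n → Fin n) (A : Mat n) → (∀ y → A y (f y) ≡ true) → funMat f ≤ᴹ A
funMat-≤ᴹ f A graph y z fyz = subst (λ z → A y z ≡ true) (⌊≟⌋-true⇒≡ fyz) (graph y)

autWord-≤ᴹ : (M : Fin m → Mat n) (w : Word (AutLetter M)) → prodWord (Aut M) w ≤ᴹ prodWord M (mapWord proj₁ w)
autWord-≤ᴹ M (a , as) = autList-≤ᴹ a as
  where
  autList-≤ᴹ : (a : AutLetter M) (as : List (AutLetter M))
    → prodList (Aut M) a as ≤ᴹ prodList M (proj₁ a) (map proj₁ as)
  autList-≤ᴹ (i , f , f≤Mi) []       = f≤Mi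
  autList-≤ᴹ (i , f , f≤Mi) (a ∷ as) = ⊗-mono f≤Mi (autList-≤ᴹ a as)

Reaches : (I → Mat n) → List I → Fin n → Fin n → Set
Reaches M []      x y = x ≡ y
Reaches M (j ∷ w) x y = prodList M j w x y ≡ true

prodList-first : (M : I → Mat n) (i : I) (w : List I) {z y : Fin n}
  → prodList M i w z y ≡ true → ∃ λ x → M i z x ≡ true × Reaches M w x y
prodList-first M i []      Mizy = _ , Mizy , refl
prodList-first M i (j ∷ w) {z} {y} prod with anyFin-elim (λ s → M i z s ∧ prodList M j w s y) prod
... | x , step = x , ∧-conicalˡ _ _ step , ∧-conicalʳ _ _ step

reverseOnto-transpose : (M : I → Mat n) (i : I) (acc w : List I) {x y z : Fin n}
  → prodList (transpose ∘ M) i acc x z ≡ true → Reaches M w x y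
  → prodWord (transpose ∘ M) (reverseOnto i acc w) y z ≡ true
reverseOnto-transpose M i acc []      back refl = back
reverseOnto-transpose M i acc (j ∷ w) {x} {z = z} back forth with prodList-first M j w forth
... | x′ , Mjxx′ , rest = reverseOnto-transpose M j (i ∷ acc) w
  (anyFin-intro (λ s → M j s x′ ∧ prodList (transpose ∘ M) i acc s z) x (∧-intro Mjxx′ back)) rest

prodWord-transpose : (M : I → Mat n) (w : Word I)
  → transpose (prodWord M w) ≤ᴹ prodWord (transpose ∘ M) (reverseWord w)
prodWord-transpose M (i , w) y z prod with prodList-first M i w prod
... | x , Mizx , rest = reverseOnto-transpose M i [] w Mizx rest

chooseEntry : (R S : Fin n → Bool) → ∃ (λ x → R x ≡ true)
  → ∃ λ x → R x ≡ true × (anyFin (λ x′ → R x′ ∧ S x′) ≡ true → S x ≡ true)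
chooseEntry R S (x₀ , Rx₀) with any? (λ x → R x ∧ S x ≟ᵇ true)
... | yes (x , RSx) = x , ∧-conicalˡ _ _ RSx , λ _ → ∧-conicalʳ _ _ RSx
... | no ¬RS        = x₀ , Rx₀ , λ meets → contradiction (anyFin-elim _ meets) ¬RS

module _ (M : Fin m → Mat n) (nonzeroRows : ∀ i y → ∃ λ x → M i y x ≡ true) where

  private
    choice : ∀ i (S : Fin n → Bool) y
      → ∃ λ x → M i y x ≡ true × (anyFin (λ x′ → M i y x′ ∧ S x′) ≡ true → S x ≡ true)
    choice i S y = chooseEntry (M i y) S (nonzeroRows i y)

  guidedLetter : Fin m → (Fin n → Bool) → AutLetter M
  guidedLetter i S = i , proj₁ ∘ choice i S , funMat-≤ᴹ (proj₁ ∘ choice i S) (M i) (proj₁ ∘ proj₂ ∘ choice i S)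

  guidedLetter-step : ∀ i S y → anyFin (λ x → M i y x ∧ S x) ≡ true
    → ∃ λ x → Aut M (guidedLetter i S) y x ≡ true × S x ≡ true
  guidedLetter-step i S y meets =
    proj₁ (choice i S y) , funMat-diag (proj₁ ∘ choice i S) y , proj₂ (proj₂ (choice i S y)) meets

  liftList : (j : Fin n) (i : Fin m) (w : List (Fin m))
    → Σ (AutLetter M) λ a → Σ (List (AutLetter M)) λ as → length as ≡ length w
      × (∀ y → prodList M i w y j ≡ true → prodList (Aut M) a as y j ≡ true)
  liftList j i [] = guidedLetter i S , [] , refl , keeps
    where
    S : Fin n → Bool
    S x = ⌊ x ≟ j ⌋
    keeps : ∀ y → M i y j ≡ true → Aut M (guidedLetter i S) y j ≡ true
    keeps y Miyj with guidedLetter-step i S y (anyFin-intro _ j (∧-intro Miyj (funMat-diag id j)))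
    ... | x , step , x≟j = subst (λ x → Aut M (guidedLetter i S) y x ≡ true) (⌊≟⌋-true⇒≡ x≟j) step
  liftList j i (l ∷ w) with liftList j l w
  ... | a , as , length≡ , keepsRest = guidedLetter i S , a ∷ as , cong suc length≡ , keeps
    where
    S : Fin n → Bool
    S x = prodList M l w x j
    keeps : ∀ y → prodList M i (l ∷ w) y j ≡ true → prodList (Aut M) (guidedLetter i S) (a ∷ as) y j ≡ true
    keeps y prod with guidedLetter-step i S y prod
    ... | x , step , Sx = anyFin-intro _ x (∧-intro step (keepsRest x Sx))

  liftColumn : (j : Fin n) (w : Word (Fin m))
    → Σ (Word (AutLetter M)) λ w′ → wordLength w′ ≡ wordLength w
      × (∀ y → prodWord M w y j ≡ true → prodWord (Aut M) w′ y j ≡ true)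
  liftColumn j (i , w) with liftList j i w
  ... | a , as , length≡ , keeps = (a , as) , cong suc length≡ , keeps

autColumn⇒rowOrColumn : (M : Fin m → Mat n)
  → Attains (HasCol k) (Aut M) ⊆ Attains (HasRowOrCol k) M
autColumn⇒rowOrColumn M (w , refl , j , k≤col) =
  mapWord proj₁ w , wordLength-mapWord proj₁ w ,
  inj₂ (j , ≤-trans k≤col (countTrue-mono _ _ λ i → autWord-≤ᴹ M w i j))

autᵀColumn⇒rowOrColumn : (M : Fin m → Mat n)
  → Attains (HasCol k) (Aut (transposeSet M)) ⊆ Attains (HasRowOrCol k) M
autᵀColumn⇒rowOrColumn M (w , refl , j , k≤col) =
  reverseWord u , trans (wordLength-reverseWord u) (wordLength-mapWord proj₁ w) ,
  inj₁ (j , ≤-trans k≤col (countTrue-mono _ _ λ x →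
    prodWord-transpose (transposeSet M) u j x ∘ autWord-≤ᴹ (transposeSet M) w x j))
  where u = mapWord proj₁ w

rowOrColumn⇒autColumn : (M : Fin m → Mat n) → (∀ i → NZ (M i))
  → Attains (HasRowOrCol k) M ⊆ Attains (HasCol k) (Aut M) ∪ Attains (HasCol k) (Aut (transposeSet M))
rowOrColumn⇒autColumn M nz (w , refl , inj₂ (j , k≤col))
  with liftColumn M (λ i → proj₁ (nz i)) j w
... | w′ , length≡ , keeps = inj₁ (w′ , length≡ , j , ≤-trans k≤col (countTrue-mono _ _ keeps))
rowOrColumn⇒autColumn M nz (w , refl , inj₁ (i , k≤row))
  with liftColumn (transposeSet M) (λ i → proj₂ (nz i)) i (reverseWord w)
... | w′ , length≡ , keeps = inj₂ (w′ , trans length≡ (wordLength-reverseWord w) , i ,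
  ≤-trans k≤row (countTrue-mono _ _ λ x → keeps x ∘ prodWord-transpose M w x i))

rowOrColumn≐autColumns : (M : Fin m → Mat n) → (∀ i → NZ (M i))
  → Attains (HasRowOrCol k) M ≐ Attains (HasCol k) (Aut M) ∪ Attains (HasCol k) (Aut (transposeSet M))
rowOrColumn≐autColumns M nz =
  rowOrColumn⇒autColumn M nz ,
  λ { (inj₁ autWord) → autColumn⇒rowOrColumn M autWord
    ; (inj₂ autᵀWord) → autᵀColumn⇒rowOrColumn M autᵀWord }

proposition1p5 : (n m : ℕ) (M : Fin m → Mat n)
    → (∀ i → NZ (M i))
    → Primitive M
    → (k : ℕ) → 2 ≤ k → k ≤ n
    → (a b c : Maybe ℕ)
    → rtMatIs k M a
    → rtAutIs k (Aut M) b
    → rtAutIs k (Aut (transposeSet M)) c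
    → a ≡ min∞ b c
proposition1p5 n m M nz _ k _ _ a b c rtM rtAut rtAutᵀ =
  minimumIs-unique (rowOrColumn≐autColumns M nz)
    (shortestIs⇒minimumIs rtM)
    (minimumIs-∪ (shortestIs⇒minimumIs rtAut) (shortestIs⇒minimumIs rtAutᵀ))
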